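{- In the game \textsc{saliquant}, if $p$ is a prime with $p\equiv 5 \pmod 6$, then $\mathcal{SG}(2p)=\frac{p-1}{2}$.
   Context: \textsc{saliquant} is the normal-play impartial game whose positions are the positive integers, where the options of a position $n\geq 1$ are $\{n-k : 1\leq k\leq n,\ k\nmid n\}$. The nim-value is defined recursively by $\mathcal{SG}(n)=\operatorname{mex}\{\mathcal{SG}(x) : x \text{ an option of } n\}$, where $\operatorname{mex}(A)$ is the least nonnegative integer not in $A$. -}

module Defs where

open import Data.Nat using (ℕ; zero; suc; _∸_; _≡ᵇ_)
open import Data.Nat.Divisibility using (_∣?_)
open import Data.Bool using (Bool; true; false; if_then_else_)
open import Data.List using (List; []; _∷_; _++_; map; filter; upTo)
open import Data.Bool.ListAction using (any)
open import Relation.Nullary using (¬?)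
open import Relation.Nullary.Decidable using (⌊_⌋)

-- Search from 0 with fuel; the answer is at most the length of the list,
-- so fuel = length + 1 suffices; we use fuel recursion.
_∈ᵇ_ : ℕ → List ℕ → Bool
x ∈ᵇ xs = any (λ y → x ≡ᵇ y) xs

mexFrom : ℕ → ℕ → List ℕ → ℕ
mexFrom zero    i xs = i
mexFrom (suc f) i xs = if i ∈ᵇ xs then mexFrom f (suc i) xs else i

mex : List ℕ → ℕ
mex xs = mexFrom (Data.List.length xs) 0 xs

at : List ℕ → ℕ → ℕ
at []       _       = 0
at (x ∷ xs) zero    = x
at (x ∷ xs) (suc i) = at xs i

moves : ℕ → List ℕ
moves n = filter (λ k → ¬? (k ∣? n)) (map suc (upTo n))

-- table n = [SG 0, SG 1, ..., SG n]  (SG 0 := 0 by convention; 0 is never an option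
-- of a positive integer, since k = n always divides n.)
table : ℕ → List ℕ
table zero    = 0 ∷ []
table (suc n) = let t = table n in
  t ++ (mex (map (λ k → at t (suc n ∸ k)) (moves (suc n))) ∷ [])

SG : ℕ → ℕ
SG n = at (table n) n

module Submission where

-- The moves 1 and n are never legal, so every option of n sits at a
-- position ≤ n ∸ 2; by induction SG n ≤ ⌊(n ∸ 1)/2⌋, and since an even move
-- from an odd position is always legal, SG (2a + 1) = a.
-- Let p = 2a + 1 be prime with 3 ∣ p + 1.  From 2p the moves in (p, 2p) are
-- legal and reach every odd position 2j + 1 with j < a, so SG (2p) ≥ a.
-- No option of 2p has value a: the odd position p is only reached by the
-- illegal move p; an even position 2b + 2 has value ≤ b, so b ≥ a; at
-- b = a, i.e. p + 1, the moves 1, 2, 3 are illegal and the bound sharpens to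
-- SG (p + 1) < a; and for b > a the move 2b + 2 ∸ p does not divide
-- 2b + 2 (it would divide the prime p), so SG (2b + 2) ≠ SG p = a.

open import Defs
open import Data.Nat using (ℕ; _*_; _∸_; _/_; _%_)
open import Data.Nat.Primality using (Prime)
open import Relation.Binary.PropositionalEquality using (_≡_)

open import Data.Bool using (true; false)
open import Data.Bool.Properties using (T-≡)
open import Data.List using (List; []; _∷_; _++_; map; length; upTo)
open import Data.List.Properties using (length-map; length-++; map-cong-local)
open import Data.List.Membership.Propositional using (_∈_; _∉_)
open import Data.List.Membership.Propositional.Properties
  using (∈-map⁺; ∈-map⁻; ∈-filter⁺; ∈-filter⁻; ∈-upTo⁺; ∈-upTo⁻)
open import Data.List.Relation.Unary.All as All using ()
open import Data.List.Relation.Unary.Any as Any using (here; there)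
open import Data.List.Relation.Unary.Any.Properties using (any⁺; any⁻)
open import Data.Nat
open import Data.Nat.Divisibility
open import Data.Nat.DivMod using (m≡m%n+[m/n]*n; m*n/n≡m)
open import Data.Nat.Induction using (<-rec)
open import Data.Nat.Primality using (composite)
open import Data.Nat.Properties
open import Algebra.Properties.CommutativeSemigroup +-commutativeSemigroup using (x∙yz≈y∙xz)
open import Data.Nat.Tactic.RingSolver using (solve)
open import Data.Product using (∃₂; _×_; _,_)
open import Data.Sum using (inj₁; inj₂)
open import Function using (Equivalence; _∘_)
open import Relation.Binary.PropositionalEquality
open import Relation.Nullary using (¬?; yes; no; contradiction)
open import Relation.Unary using (_⊆_)

∈ᵇ⇒∈ : ∀ {x xs} → x ∈ᵇ xs ≡ true → x ∈ xs
∈ᵇ⇒∈ {x} {xs} eq = Any.map (λ {y} → ≡ᵇ⇒≡ x y) (any⁻ _ xs (Equivalence.from T-≡ eq))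

∈⇒∈ᵇ : ∀ {x xs} → x ∈ xs → x ∈ᵇ xs ≡ true
∈⇒∈ᵇ {x} x∈xs = Equivalence.to T-≡ (any⁺ _ (Any.map (λ {y} → ≡⇒≡ᵇ x y) x∈xs))

<-suc-extend : ∀ {i} {P : ℕ → Set} → (_< i) ⊆ P → P i → (_< suc i) ⊆ P
<-suc-extend below Pi j<1+i with m<1+n⇒m<n∨m≡n j<1+i
... | inj₁ j<i  = below j<i
... | inj₂ refl = Pi

mexFrom-≤ : ∀ f {i v xs} → v ∉ xs → i ≤ v → mexFrom f i xs ≤ v
mexFrom-≤ zero    v∉xs i≤v = i≤v
mexFrom-≤ (suc f) {i} {v} {xs} v∉xs i≤v with i ∈ᵇ xs in eq
... | true  = mexFrom-≤ f v∉xs (≤∧≢⇒< i≤v λ { refl → v∉xs (∈ᵇ⇒∈ eq) })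
... | false = i≤v

≤-mexFrom : ∀ f {i v xs} → (_< v) ⊆ (_∈ xs) → v ≤ f + i → v ≤ mexFrom f i xs
≤-mexFrom zero    below v≤i = v≤i
≤-mexFrom (suc f) {i} {v} {xs} below v≤f+i with i ∈ᵇ xs in eq
... | true  = ≤-mexFrom f below (subst (v ≤_) (sym (+-suc f i)) v≤f+i)
... | false with v ≤? i
...   | yes v≤i = v≤i
...   | no  v≰i with () ← trans (sym (∈⇒∈ᵇ (below (≰⇒> v≰i)))) eq

mexFrom-∈ : ∀ f {i xs} → (_< i) ⊆ (_∈ xs) → mexFrom f i xs ∈ xs → (_< suc (f + i)) ⊆ (_∈ xs)
mexFrom-∈ zero    below m∈xs = <-suc-extend below m∈xs
mexFrom-∈ (suc f) {i} {xs} below m∈xs with i ∈ᵇ xs in eq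
... | true  = subst (λ n → (_< suc n) ⊆ (_∈ xs)) (+-suc f i)
                (mexFrom-∈ f (<-suc-extend below (∈ᵇ⇒∈ eq)) m∈xs)
... | false with () ← trans (sym (∈⇒∈ᵇ m∈xs)) eq

-- Pigeonhole: deleting x and shifting the larger values down by one turns
-- a list covering 0, …, v into one of the same length covering 0, …, v − 1.
close-gap : ℕ → ℕ → ℕ
close-gap x y with x <? y
... | yes _ = pred y
... | no  _ = y

close-gap-< : ∀ {x j} → j < x → close-gap x j ≡ j
close-gap-< {x} {j} j<x with x <? j
... | yes x<j = contradiction (<-trans j<x x<j) (<-irrefl refl)
... | no  _   = refl

close-gap-≥ : ∀ {x j} → x ≤ j → close-gap x (suc j) ≡ j
close-gap-≥ {x} {j} x≤j with x <? suc j
... | yes _   = refl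
... | no  x≮ = contradiction (s≤s x≤j) x≮

below-⊆⇒≤-length : ∀ v xs → (_< v) ⊆ (_∈ xs) → v ≤ length xs
below-⊆⇒≤-length zero    xs       below = z≤n
below-⊆⇒≤-length (suc v) []       below with () ← below z<s
below-⊆⇒≤-length (suc v) (x ∷ xs) below =
  s≤s (subst (v ≤_) (length-map (close-gap x) xs)
        (below-⊆⇒≤-length v (map (close-gap x) xs) below′))
  where
  below′ : (_< v) ⊆ (_∈ map (close-gap x) xs)
  below′ {j} j<v with j <? x
  ... | yes j<x with below (m<n⇒m<1+n j<v)
  ...   | here refl = contradiction j<x (<-irrefl refl)
  ...   | there j∈  = subst (_∈ _) (close-gap-< j<x) (∈-map⁺ (close-gap x) j∈)
  below′ {j} j<v | no j≮x with below (s≤s j<v)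
  ...   | here refl = contradiction (≮⇒≥ j≮x) (<-irrefl refl)
  ...   | there j∈  = subst (_∈ _) (close-gap-≥ (≮⇒≥ j≮x)) (∈-map⁺ (close-gap x) j∈)

mex-≤ : ∀ {v xs} → v ∉ xs → mex xs ≤ v
mex-≤ {xs = xs} v∉xs = mexFrom-≤ (length xs) v∉xs z≤n

≤-mex : ∀ {v xs} → (_< v) ⊆ (_∈ xs) → v ≤ mex xs
≤-mex {v} {xs} below =
  ≤-mexFrom (length xs) below (≤-trans (below-⊆⇒≤-length v xs below) (m≤m+n _ 0))

mex-∉ : ∀ xs → mex xs ∉ xs
mex-∉ xs m∈xs = <-irrefl refl
  (≤-trans (below-⊆⇒≤-length _ xs (mexFrom-∈ (length xs) (λ ()) m∈xs))
           (≤-reflexive (sym (+-identityʳ (length xs)))))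

length-table : ∀ n → length (table n) ≡ suc n
length-table zero    = refl
length-table (suc n) = trans (length-++ (table n)) (trans (cong (_+ 1) (length-table n)) (+-comm (suc n) 1))

at-++ˡ : ∀ xs ys {i} → i < length xs → at (xs ++ ys) i ≡ at xs i
at-++ˡ (x ∷ xs) ys {zero}  _         = refl
at-++ˡ (x ∷ xs) ys {suc i} (s≤s i<n) = at-++ˡ xs ys i<n

at-++-length : ∀ xs y → at (xs ++ y ∷ []) (length xs) ≡ y
at-++-length []       y = refl
at-++-length (x ∷ xs) y = at-++-length xs y

at-table′ : ∀ d i → at (table (d + i)) i ≡ SG i
at-table′ zero    i = refl
at-table′ (suc d) i =
  trans (at-++ˡ (table (d + i)) _ (subst (i <_) (sym (length-table (d + i))) (s≤s (m≤n+m i d))))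
        (at-table′ d i)

at-table : ∀ {i n} → i ≤ n → at (table n) i ≡ SG i
at-table {i} {n} i≤n = subst (λ m → at (table m) i ≡ SG i) (m∸n+n≡m i≤n) (at-table′ (n ∸ i) i)

options : ℕ → List ℕ
options n = map (λ k → SG (n ∸ k)) (moves n)

∈-moves⁺ : ∀ {n k} → k < n → suc k ∤ n → suc k ∈ moves n
∈-moves⁺ {n} k<n k∤n = ∈-filter⁺ (λ k → ¬? (k ∣? n)) (∈-map⁺ suc (∈-upTo⁺ k<n)) k∤n

∈-moves⁻ : ∀ {n k} → k ∈ moves n → 1 ≤ k × k ≤ n × k ∤ n
∈-moves⁻ {n} k∈ with ∈-filter⁻ (λ k → ¬? (k ∣? n)) {xs = map suc (upTo n)} k∈
... | k∈′ , k∤n with ∈-map⁻ suc k∈′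
...   | k′ , k′∈ , refl = s≤s z≤n , ∈-upTo⁻ k′∈ , k∤n

SG-mex : ∀ n → SG n ≡ mex (options n)
SG-mex zero    = refl
SG-mex (suc n) = begin
  SG (suc n)             ≡⟨ subst (λ i → at (table n ++ mex L ∷ []) i ≡ mex L) (length-table n)
                                  (at-++-length (table n) (mex L)) ⟩
  mex L                  ≡⟨ cong mex (map-cong-local (All.tabulate at-table-option)) ⟩
  mex (options (suc n))  ∎
  where
  open ≡-Reasoning
  L : List ℕ
  L = map (λ k → at (table n) (suc n ∸ k)) (moves (suc n))
  at-table-option : ∀ {k} → k ∈ moves (suc n) → at (table n) (suc n ∸ k) ≡ SG (suc n ∸ k)
  at-table-option k∈ with ∈-moves⁻ {suc n} k∈
  ... | s≤s {n = k} z≤n , _ = at-table (m∸n≤m n k)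

SG-≤ : ∀ {n v} → v ∉ options n → SG n ≤ v
SG-≤ {n} v∉ = subst (_≤ _) (sym (SG-mex n)) (mex-≤ v∉)

≤-SG : ∀ {n v} → (_< v) ⊆ (_∈ options n) → v ≤ SG n
≤-SG {n} below = subst (_ ≤_) (sym (SG-mex n)) (≤-mex below)

SG-∉ : ∀ n → SG n ∉ options n
SG-∉ n = subst (_∉ options n) (sym (SG-mex n)) (mex-∉ (options n))

option⁺ : ∀ {n x k} → n ≡ x + suc k → suc k ∤ n → SG x ∈ options n
option⁺ {x = x} {k} refl k∤n =
  subst (_∈ options (x + suc k)) (cong SG (m+n∸n≡m x (suc k)))
        (∈-map⁺ (λ m → SG (x + suc k ∸ m)) (∈-moves⁺ (m≤n+m (suc k) x) k∤n))

option⁻ : ∀ {n v} → v ∈ options n →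
          ∃₂ λ x k → n ≡ suc x + suc k × suc k ∤ n × v ≡ SG (suc x)
option⁻ {n} v∈ with ∈-map⁻ _ v∈
... | k , k∈ , refl with ∈-moves⁻ {n} k∈
...   | s≤s {n = k} z≤n , k<n , k∤n with m≤n⇒m<n∨m≡n k<n
...     | inj₂ refl = contradiction ∣-refl k∤n
...     | inj₁ k<n with m≤n⇒∃[o]m+o≡n k<n
...       | x , refl = x , k , n≡ , k∤n ,
                      trans (cong (λ m → SG (m ∸ suc k)) n≡) (cong SG (m+n∸n≡m (suc x) (suc k)))
  where
  n≡ : suc (suc k + x) ≡ suc x + suc k
  n≡ = cong suc (+-comm (suc k) x)

SG-option-≢ : ∀ {n x k} → n ≡ x + suc k → suc k ∤ n → SG n ≢ SG x
SG-option-≢ {n} n≡ k∤n eq = SG-∉ n (subst (_∈ options n) (sym eq) (option⁺ n≡ k∤n))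

data ParityView : ℕ → Set where
  even : ∀ b → ParityView (b + b)
  odd  : ∀ b → ParityView (suc (b + b))

parityView : ∀ n → ParityView n
parityView zero          = even 0
parityView (suc zero)    = odd 0
parityView (suc (suc n)) with parityView n
... | even b = subst ParityView (cong suc (+-suc b b)) (even (suc b))
... | odd  b = subst ParityView (cong (suc ∘ suc) (+-suc b b)) (odd (suc b))

2∣double : ∀ m → 2 ∣ m + m
2∣double m = divides m (solve (m ∷ []))

double∤odd : ∀ m n → m + m ∤ suc (n + n)
double∤odd m n m+m∣ = contradiction (∣1⇒≡1 2∣1) λ ()
  where
  2∣1 : 2 ∣ 1
  2∣1 = ∣m+n∣m⇒∣n (subst (2 ∣_) (+-comm 1 (n + n)) (∣-trans (2∣double m) m+m∣)) (2∣double n)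

∤-between : ∀ {m k} → m < k → k < m + m → k ∤ m + m
∤-between {m} {k} m<k k<2m (divides q 2m≡qk) with q | 2m≡qk
... | 0           | 2m≡0 = contradiction (subst (k <_) 2m≡0 k<2m) λ ()
... | 1           | 2m≡k = <-irrefl (trans (sym (+-identityʳ k)) (sym 2m≡k)) k<2m
... | suc (suc q) | 2m≡  = <⇒≱ (+-mono-< m<k m<k)
                               (≤-trans (+-monoʳ-≤ k (m≤m+n k (q * k))) (≤-reflexive (sym 2m≡)))

DivisibleUpTo : ℕ → ℕ → Set
DivisibleUpTo d n = ∀ {j} → 1 ≤ j → j ≤ d → j ∣ n

divisibleUpTo-1 : ∀ n → DivisibleUpTo 1 n
divisibleUpTo-1 n (s≤s z≤n) (s≤s z≤n) = 1∣ n

nondivisor-> : ∀ {n d k} → DivisibleUpTo d n → suc k ∤ n → d < suc k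
nondivisor-> divisors k∤n = ≰⇒> (λ k≤d → k∤n (divisors (s≤s z≤n) k≤d))

HalfBoundBelow : ℕ → Set
HalfBoundBelow n = ∀ {x} → suc x < n → SG (suc x) + SG (suc x) ≤ x

option-bound : ∀ {n d v} → HalfBoundBelow n → DivisibleUpTo d n → v ∈ options n → suc d + (v + v) < n
option-bound {d = d} bound divisors v∈ with option⁻ v∈
... | x , k , refl , k∤n , refl = begin-strict
  suc d + (SG (suc x) + SG (suc x)) ≤⟨ +-mono-≤ (nondivisor-> divisors k∤n) (bound (m<m+n (suc x) z<s)) ⟩
  suc k + x                         ≡⟨ +-comm (suc k) x ⟩
  x + suc k                         <⟨ n<1+n _ ⟩
  suc x + suc k                     ∎
  where open ≤-Reasoning

SG-≤-of-divisors : ∀ {n d c} → HalfBoundBelow n → DivisibleUpTo d n → n ≤ suc d + (c + c) → SG n ≤ c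
SG-≤-of-divisors bound divisors n≤ = SG-≤ (λ c∈ → <⇒≱ (option-bound bound divisors c∈) n≤)

SG-bound : ∀ x → SG (suc x) + SG (suc x) ≤ x
SG-bound = <-rec _ λ x IH → go (λ sy<sx → IH (≤-pred sy<sx)) (parityView x)
  where
  go : ∀ {x} → HalfBoundBelow (suc x) → ParityView x → SG (suc x) + SG (suc x) ≤ x
  go bound (even c) = +-mono-≤ SG≤c SG≤c
    where
    SG≤c : SG (suc (c + c)) ≤ c
    SG≤c = SG-≤-of-divisors bound (divisibleUpTo-1 _) (n≤1+n _)
  go bound (odd c)  = ≤-trans (+-mono-≤ SG≤c SG≤c) (n≤1+n _)
    where
    SG≤c : SG (suc (suc (c + c))) ≤ c
    SG≤c = SG-≤-of-divisors bound (divisibleUpTo-1 _) ≤-refl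

halfBoundBelow : ∀ n → HalfBoundBelow n
halfBoundBelow n {x} _ = SG-bound x

SG-≤-half : ∀ {n c} → n ≤ suc (suc (c + c)) → SG n ≤ c
SG-≤-half {n} = SG-≤-of-divisors (halfBoundBelow n) (divisibleUpTo-1 n)

odd-split : ∀ {a} j e → suc j + e ≡ a → suc (a + a) ≡ suc (j + j) + (suc e + suc e)
odd-split j e refl = solve (j ∷ e ∷ [])

even-split : ∀ {b} a c → suc a + c ≡ b → suc (suc (b + b)) ≡ suc (a + a) + suc (suc (suc (c + c)))
even-split a c refl = solve (a ∷ c ∷ [])

SG-odd : ∀ a → SG (suc (a + a)) ≡ a
SG-odd = <-rec _ λ a IH → ≤-antisym (SG-≤-half (n≤1+n _)) (≤-SG (reach IH))
  where
  reach : ∀ {a} → (∀ {j} → j < a → SG (suc (j + j)) ≡ j) → (_< a) ⊆ (_∈ options (suc (a + a)))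
  reach {a} IH {j} j<a with m≤n⇒∃[o]m+o≡n j<a
  ... | e , a≡ =
    subst (_∈ _) (IH j<a) (option⁺ {x = suc (j + j)} (odd-split j e a≡) (double∤odd (suc e) a))

SG-even-< : ∀ {a} → 3 ∣ suc (suc (a + a)) → SG (suc (suc (a + a))) < a
SG-even-< {zero}  3∣2 = contradiction (∣⇒≤ 3∣2) λ { (s≤s (s≤s ())) }
SG-even-< {suc c} 3∣n = s≤s (SG-≤-of-divisors (halfBoundBelow n) divisors n≤)
  where
  n : ℕ
  n = suc (suc (suc c + suc c))
  divisors : DivisibleUpTo 3 n
  divisors (s≤s z≤n) (s≤s z≤n)             = 1∣ n
  divisors (s≤s z≤n) (s≤s (s≤s z≤n))       =
    subst (2 ∣_) (cong suc (+-suc (suc c) (suc c))) (2∣double (suc (suc c)))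
  divisors (s≤s z≤n) (s≤s (s≤s (s≤s z≤n))) = 3∣n
  n≤ : n ≤ 4 + (c + c)
  n≤ = ≤-reflexive (cong (3 +_) (+-suc c c))

module TwicePrime {a} (p-prime : Prime (suc (a + a))) (3∣p+1 : 3 ∣ suc (suc (a + a))) where

  p : ℕ
  p = suc (a + a)

  SG-even-≢ : ∀ {b} → suc (suc (b + b)) < p + p → SG (suc (suc (b + b))) ≢ a
  SG-even-≢ {b} m<2p SG≡a with m≤n⇒m<n∨m≡n (subst (_≤ b) SG≡a (SG-≤-half ≤-refl))
  ... | inj₂ refl = <-irrefl SG≡a (SG-even-< 3∣p+1)
  ... | inj₁ a<b with m≤n⇒∃[o]m+o≡n a<b
  ...   | c , b≡ = SG-option-≢ {x = p} m≡ E∤m (trans SG≡a (sym (SG-odd a)))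
    where
    E : ℕ
    E = suc (suc (suc (c + c)))
    m≡ : suc (suc (b + b)) ≡ p + E
    m≡ = even-split a c b≡
    E<p : E < p
    E<p = +-cancelˡ-< p E p (subst (_< p + p) m≡ m<2p)
    E∤m : E ∤ suc (suc (b + b))
    E∤m E∣m = Prime.notComposite p-prime (composite E<p E∣p)
      where
      E∣p : E ∣ p
      E∣p = ∣m+n∣m⇒∣n (subst (E ∣_) (trans m≡ (+-comm p E)) E∣m) ∣-refl

  SG-twice : SG (p + p) ≡ a
  SG-twice = ≤-antisym (SG-≤ a∉) (≤-SG reach)
    where
    reach : (_< a) ⊆ (_∈ options (p + p))
    reach {j} j<a with m≤n⇒∃[o]m+o≡n j<a
    ... | e , a≡ = subst (_∈ _) (SG-odd j)
                     (option⁺ {x = suc (j + j)} 2p≡ (∤-between (m<m+n p z<s) (+-monoʳ-< p E<p)))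
      where
      E : ℕ
      E = suc e + suc e
      p≡ : p ≡ suc (j + j) + E
      p≡ = odd-split j e a≡
      2p≡ : p + p ≡ suc (j + j) + (p + E)
      2p≡ = trans (cong (p +_) p≡) (x∙yz≈y∙xz p (suc (j + j)) E)
      E<p : E < p
      E<p = subst (E <_) (sym p≡) (m<n+m E z<s)
    a∉ : a ∉ options (p + p)
    a∉ a∈ with option⁻ a∈
    ... | x , k , 2p≡ , k∤2p , a≡ with parityView x
    ...   | odd b  = SG-even-≢ {b} (subst (suc (suc (b + b)) <_) (sym 2p≡) (m<m+n _ z<s)) (sym a≡)
    ...   | even b with trans a≡ (SG-odd b)
    ...     | refl = k∤2p (subst (_∣ p + p) (+-cancelˡ-≡ p p (suc k) 2p≡) (∣m∣n⇒∣m+n ∣-refl ∣-refl))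

SG-twice-5-mod-6 : ∀ q → Prime (5 + q * 6) → SG (2 * (5 + q * 6)) ≡ (4 + q * 6) / 2
SG-twice-5-mod-6 q p-prime = begin
  SG (2 * p)      ≡⟨ cong (λ n → SG (2 * n)) p≡ ⟩
  SG (2 * p′)     ≡⟨ cong (λ n → SG (p′ + n)) (+-identityʳ p′) ⟩
  SG (p′ + p′)    ≡⟨ TwicePrime.SG-twice (subst Prime p≡ p-prime) 3∣p+1 ⟩
  a               ≡⟨ m*n/n≡m a 2 ⟨
  a * 2 / 2       ≡⟨ cong (_/ 2) 2a≡ ⟩
  (4 + q * 6) / 2 ∎
  where
  open ≡-Reasoning
  p a p′ : ℕ
  p  = 5 + q * 6
  a  = 2 + q * 3
  p′ = suc (a + a)
  p≡ : 5 + q * 6 ≡ suc ((2 + q * 3) + (2 + q * 3))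
  p≡ = solve (q ∷ [])
  2a≡ : (2 + q * 3) * 2 ≡ 4 + q * 6
  2a≡ = solve (q ∷ [])
  3∣p+1 : 3 ∣ suc (suc ((2 + q * 3) + (2 + q * 3)))
  3∣p+1 = divides (2 + q * 2) (solve (q ∷ []))

mainTheorem2 : (p : ℕ) → Prime p → p % 6 ≡ 5 → SG (2 * p) ≡ (p ∸ 1) / 2
mainTheorem2 p p-prime p%6≡5 =
  subst (λ p → SG (2 * p) ≡ (p ∸ 1) / 2) (sym p≡)
        (SG-twice-5-mod-6 (p / 6) (subst Prime p≡ p-prime))
  where
  p≡ : p ≡ 5 + p / 6 * 6
  p≡ = trans (m≡m%n+[m/n]*n p 6) (cong (_+ p / 6 * 6) p%6≡5)
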